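{- Let $n \ge 1$ and $d\ge 1$ be integers, let $Q = \{\pm1\}^{n+1}$ with coordinates indexed $0,1,\dots,n$, and let $Q^- = \{x\in Q: x_0=-1\}$, $Q^+ = \{x \in Q: x_0 = +1\}$. Let $\phi:\{\pm1\}^2\to[4]$ be given by $\phi(-1,-1)=1$, $\phi(-1,+1)=2$, $\phi(+1,-1)=3$, $\phi(+1,+1)=4$, and define the bijection $\Phi : Q^-\times Q^+ \to [4]^n$ by $\Phi(x^-,x^+) = (\phi(x^-_1,x^+_1),\dots,\phi(x^-_n,x^+_n))$. Then for a set $S \subseteq Q^-\times Q^+$, $S$ is a $d$-dimensional hyperbowtie if and only if $\Phi(S)$ is a $d$-dimensional tic-tac-toe space in $[4]^n$.
   Context: A $k$-parameter subset of $A^n$ (for finite $A$ and a group $G$ acting on $A$) is the image of an injective map $f: A^k\to A^n$ such that each coordinate $f_i$ is either a constant $a\in A$ or $\sigma(x_j)$ for some $1\le j\le k$, $\sigma\in G$. A $(d+1)$-dimensional subcube of $Q=\{\pm1\}^{n+1}$ is a $(d+1)$-parameter subset with $A=\{\pm1\}$, $G=\{x\mapsto x, x\mapsto -x\}$. A $d$-dimensional hyperbowtie is, for a $(d+1)$-dimensional subcube $C$ of $Q$ with half of its vertices in $Q^-$ and half in $Q^+$, the set of edges of $C$ going from $Q^-$ to $Q^+$, i.e. the set of pairs $(x^-,x^+)$ with $x^- \in C\cap Q^-$, $x^+\in C\cap Q^+$. A $d$-dimensional tic-tac-toe space in $[4]^n$ is a $d$-parameter subset with $A=[4]$ and $G=\{e,\pi\}$,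 $e(x)=x$, $\pi(x)=5-x$. -}

module Defs where

open import Data.Nat using (ℕ; zero; suc; _*_; _^_)
open import Data.Fin using (Fin)
open import Data.Vec using (Vec; []; _∷_; map; head; tail; zipWith)
open import Data.List using (List; length; filter; _++_) renaming ([] to []ₗ; _∷_ to _∷ₗ_; map to mapₗ)
open import Data.Product using (Σ; ∃; _×_; _,_; proj₁; proj₂)
open import Relation.Binary.PropositionalEquality using (_≡_; refl)
open import Relation.Nullary using (Dec; yes; no)
open import Relation.Unary using (Pred)
open import Level using (0ℓ)
open import Function.Bundles using (_⇔_)
open import Function.Definitions using (Injective)

data PM : Set where
  neg : PM
  pos : PM

_≟PM_ : (a b : PM) → Dec (a ≡ b)
neg ≟PM neg = yes refl
neg ≟PM pos = no λ ()
pos ≟PM neg = no λ ()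
pos ≟PM pos = yes refl

negate : PM → PM
negate neg = pos
negate pos = neg

data Four : Set where
  f1 f2 f3 f4 : Four

-- Generic k-parameter subsets of A^n for a group G acting on A
-- (G given as a type of group elements with an action act).

data Coord (A G : Set) (k : ℕ) : Set where
  const : A → Coord A G k
  var   : G → Fin k → Coord A G k

evalCoord : {A G : Set} {k : ℕ} → (G → A → A) → Coord A G k → Vec A k → A
evalCoord act (const a)   x = a
evalCoord act (var σ j)   x = act σ (Data.Vec.lookup x j)

evalSpec : {A G : Set} {k n : ℕ} → (G → A → A) → Vec (Coord A G k) n → Vec A k → Vec A n
evalSpec act spec x = map (λ c → evalCoord act c x) spec

IsImage : {X Y : Set} → (X → Y) → Pred Y 0ℓ → Set
IsImage {X} f S = ∀ y → S y ⇔ (∃ λ (x : X) → f x ≡ y)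

IsParamSubsetVia : (A G : Set) → (G → A → A) → (k n : ℕ) →
                   Vec (Coord A G k) n → Pred (Vec A n) 0ℓ → Set
IsParamSubsetVia A G act k n spec S =
  Injective _≡_ _≡_ (evalSpec act spec) × IsImage (evalSpec act spec) S

IsParamSubset : (A G : Set) → (G → A → A) → (k n : ℕ) → Pred (Vec A n) 0ℓ → Set
IsParamSubset A G act k n S = Σ (Vec (Coord A G k) n) λ spec → IsParamSubsetVia A G act k n spec S

data CubeSym : Set where
  idC negC : CubeSym

cubeAct : CubeSym → PM → PM
cubeAct idC  x = x
cubeAct negC x = negate x

data TTTSym : Set where
  e π : TTTSym

piFour : Four → Four
piFour f1 = f4
piFour f2 = f3
piFour f3 = f2
piFour f4 = f1

tttAct : TTTSym → Four → Four
tttAct e x = x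
tttAct π x = piFour x

IsTicTacToe : (d n : ℕ) → Pred (Vec Four n) 0ℓ → Set
IsTicTacToe d n T = IsParamSubset Four TTTSym tttAct d n T

-- Q = {±1}^{n+1}, coordinates 0..n (coordinate 0 is the head)

allVecs : (k : ℕ) → List (Vec PM k)
allVecs zero    = [] ∷ₗ []ₗ
allVecs (suc k) = mapₗ (neg ∷_) (allVecs k) ++ mapₗ (pos ∷_) (allVecs k)

-- number of parameter values x ∈ {±1}^k with f(x)_0 = s
-- (for injective f this is |image(f) ∩ {y : y_0 = s}|)
countHead : {k n : ℕ} → (Vec PM k → Vec PM (suc n)) → PM → ℕ
countHead {k} f s = length (filter (λ x → head (f x) ≟PM s) (allVecs k))

-- d-dimensional hyperbowtie: there is a (d+1)-dimensional subcube C of Q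
-- (witnessed by its parametrization spec), with half of its 2^(d+1) vertices
-- in Q⁻ and half in Q⁺, and S = (C ∩ Q⁻) × (C ∩ Q⁺).
IsHyperbowtie : (n d : ℕ) → Pred (Vec PM (suc n) × Vec PM (suc n)) 0ℓ → Set₁
IsHyperbowtie n d S =
  Σ (Pred (Vec PM (suc n)) 0ℓ) λ C →
  Σ (Vec (Coord PM CubeSym (suc d)) (suc n)) λ spec →
    IsParamSubsetVia PM CubeSym cubeAct (suc d) (suc n) spec C ×
    2 * countHead (evalSpec cubeAct spec) neg ≡ 2 ^ suc d ×
    2 * countHead (evalSpec cubeAct spec) pos ≡ 2 ^ suc d ×
    (∀ p → S p ⇔ ((C (proj₁ p) × head (proj₁ p) ≡ neg) × (C (proj₂ p) × head (proj₂ p) ≡ pos)))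

phi : PM → PM → Four
phi neg neg = f1
phi neg pos = f2
phi pos neg = f3
phi pos pos = f4

Phi : {n : ℕ} → Vec PM (suc n) × Vec PM (suc n) → Vec Four n
Phi (xm , xp) = zipWith phi (tail xm) (tail xp)

PhiImage : {n : ℕ} → Pred (Vec PM (suc n) × Vec PM (suc n)) 0ℓ → Pred (Vec Four n) 0ℓ
PhiImage S y = ∃ λ p → S p × Phi p ≡ y

InQmQp : {n : ℕ} → Pred (Vec PM (suc n) × Vec PM (suc n)) 0ℓ → Set
InQmQp S = ∀ p → S p → head (proj₁ p) ≡ neg × head (proj₂ p) ≡ pos

-- Since C meets Q⁻ and
-- Q⁺ in equally many vertices, the coordinate 0 of C is a free coordinate ±x_j, so the edges
-- of the hyperbowtie are the pairs of vertices of C with x_j fixed to the two values that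
-- put them in Q⁻ and Q⁺, the remaining d parameters being chosen independently on the two
-- sides. Under φ a coordinate of C that is a constant a becomes the constant φ(a,a), one
-- that is ±x_j becomes the constant 2 or 3, and one that is ±x_k with k ≠ j becomes the
-- tic-tac-toe coordinate e or π applied to the k-th letter, because φ(-a,-b) = 5 - φ(a,b).
-- Conversely a tic-tac-toe space lifts to a subcube with one new parameter t as its
-- coordinate 0, the constants 2 and 3 becoming the coordinates t and -t.
module Submission where

open import Defs
open import Data.Nat using (ℕ; zero; suc; _≤_; _+_; _*_; _^_)
open import Data.Nat.Properties using (+-identityʳ; m^n>0; <⇒≢)
open import Data.Fin using (Fin; punchIn; punchOut) renaming (zero to fzero; suc to fsuc; _≟_ to _≟Fin_)
open import Data.Fin.Properties using (punchIn-punchOut)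
open import Data.Vec using (Vec; []; _∷_; lookup; insertAt; removeAt; zipWith; unzipWith; head; tail)
  renaming (map to mapᵥ)
open import Data.Vec.Properties
  using (lookup-zipWith; insertAt-lookup; insertAt-punchIn; removeAt-insertAt; insertAt-removeAt;
         ∷-injective; map-∘; map-cong; map-id)
open import Data.List using (List; length; filter; _++_) renaming (map to mapₗ)
open import Data.List.Properties using (length-++; length-map; filter-++; filter-all; filter-none)
import Data.List.Relation.Unary.All as All
open import Data.List.Relation.Unary.All.Properties using (map⁺)
open import Data.Product using (∃; _×_; _,_; proj₁; proj₂; uncurry)
import Data.Product as Product
open import Relation.Binary.PropositionalEquality
open import Relation.Nullary using (yes; no; ¬_)
open import Relation.Unary using (Pred; Decidable)
open import Data.Empty using (⊥-elim)
open import Level using (0ℓ)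
open import Function.Bundles using (_⇔_; mk⇔; Equivalence)
open import Function.Definitions using (Injective)
import Function.Properties.Equivalence as ⇔

open Equivalence using (to; from)

unphi : Four → PM × PM
unphi f1 = neg , neg
unphi f2 = neg , pos
unphi f3 = pos , neg
unphi f4 = pos , pos

unphi-phi : ∀ a b → unphi (phi a b) ≡ (a , b)
unphi-phi neg neg = refl
unphi-phi neg pos = refl
unphi-phi pos neg = refl
unphi-phi pos pos = refl

phi-unphi : ∀ w → uncurry phi (unphi w) ≡ w
phi-unphi f1 = refl
phi-unphi f2 = refl
phi-unphi f3 = refl
phi-unphi f4 = refl

unzipPhi : ∀ {k} → Vec Four k → Vec PM k × Vec PM k
unzipPhi = unzipWith unphi

unzipPhi-zipWith-phi : ∀ {k} (u v : Vec PM k) → unzipPhi (zipWith phi u v) ≡ (u , v)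
unzipPhi-zipWith-phi []       []       = refl
unzipPhi-zipWith-phi (a ∷ u) (b ∷ v) =
  cong₂ (Product.zip _∷_ _∷_) (unphi-phi a b) (unzipPhi-zipWith-phi u v)

zipWith-phi-unzipPhi : ∀ {k} (w : Vec Four k) → uncurry (zipWith phi) (unzipPhi w) ≡ w
zipWith-phi-unzipPhi []       = refl
zipWith-phi-unzipPhi (w ∷ ws) = cong₂ _∷_ (phi-unphi w) (zipWith-phi-unzipPhi ws)

zipWith-phi-injective : ∀ {k} {u v u′ v′ : Vec PM k} →
                        zipWith phi u v ≡ zipWith phi u′ v′ → (u , v) ≡ (u′ , v′)
zipWith-phi-injective {u = u} {v} {u′} {v′} eq = begin
  (u , v)                       ≡⟨ sym (unzipPhi-zipWith-phi u v) ⟩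
  unzipPhi (zipWith phi u v)    ≡⟨ cong unzipPhi eq ⟩
  unzipPhi (zipWith phi u′ v′)  ≡⟨ unzipPhi-zipWith-phi u′ v′ ⟩
  (u′ , v′)                     ∎
  where open ≡-Reasoning

InQ⁻×Q⁺ : ∀ {n} → Pred (Vec PM (suc n) × Vec PM (suc n)) 0ℓ
InQ⁻×Q⁺ (x⁻ , x⁺) = head x⁻ ≡ neg × head x⁺ ≡ pos

Phi-injectiveOnQ⁻×Q⁺ : ∀ {n} {p q : Vec PM (suc n) × Vec PM (suc n)} →
                       InQ⁻×Q⁺ p → InQ⁻×Q⁺ q → Phi p ≡ Phi q → p ≡ q
Phi-injectiveOnQ⁻×Q⁺ {p = neg ∷ _ , pos ∷ _} {neg ∷ _ , pos ∷ _} _ _ eq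
  with refl ← zipWith-phi-injective eq = refl

Bowtie : ∀ {n} → Pred (Vec PM (suc n)) 0ℓ → Pred (Vec PM (suc n) × Vec PM (suc n)) 0ℓ
Bowtie C (x⁻ , x⁺) = (C x⁻ × head x⁻ ≡ neg) × (C x⁺ × head x⁺ ≡ pos)

Bowtie⊆Q⁻×Q⁺ : ∀ {n} (C : Pred (Vec PM (suc n)) 0ℓ) → InQmQp (Bowtie C)
Bowtie⊆Q⁻×Q⁺ C _ ((_ , x⁻∈Q⁻) , (_ , x⁺∈Q⁺)) = x⁻∈Q⁻ , x⁺∈Q⁺

PhiImage-reflects-⊆ : ∀ {n} {S S′ : Pred (Vec PM (suc n) × Vec PM (suc n)) 0ℓ} →
                      InQmQp S → InQmQp S′ → (∀ y → PhiImage S y → PhiImage S′ y) →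
                      ∀ p → S p → S′ p
PhiImage-reflects-⊆ {S′ = S′} S⊆ S′⊆ image⊆ p Sp with image⊆ (Phi p) (p , Sp , refl)
... | q , S′q , Φq≡Φp = subst S′ (Phi-injectiveOnQ⁻×Q⁺ (S′⊆ q S′q) (S⊆ p Sp) Φq≡Φp) S′q

liftSym : CubeSym → TTTSym
liftSym idC  = e
liftSym negC = π

phi-equivariant : ∀ τ a b → phi (cubeAct τ a) (cubeAct τ b) ≡ tttAct (liftSym τ) (phi a b)
phi-equivariant idC  a   b   = refl
phi-equivariant negC neg neg = refl
phi-equivariant negC neg pos = refl
phi-equivariant negC pos neg = refl
phi-equivariant negC pos pos = refl

cubeAct-involutive : ∀ τ a → cubeAct τ (cubeAct τ a) ≡ a
cubeAct-involutive idC  a   = refl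
cubeAct-involutive negC neg = refl
cubeAct-involutive negC pos = refl

length-allVecs : ∀ k → length (allVecs k) ≡ 2 ^ k
length-allVecs zero    = refl
length-allVecs (suc k) = begin
  length (mapₗ (neg ∷_) (allVecs k) ++ mapₗ (pos ∷_) (allVecs k))
    ≡⟨ length-++ (mapₗ (neg ∷_) (allVecs k)) ⟩
  length (mapₗ (neg ∷_) (allVecs k)) + length (mapₗ (pos ∷_) (allVecs k))
    ≡⟨ cong₂ _+_ (length-map (neg ∷_) (allVecs k)) (length-map (pos ∷_) (allVecs k)) ⟩
  length (allVecs k) + length (allVecs k)
    ≡⟨ cong₂ _+_ (length-allVecs k) (trans (length-allVecs k) (sym (+-identityʳ (2 ^ k)))) ⟩
  2 ^ k + (2 ^ k + 0) ∎
  where open ≡-Reasoning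

module _ {k : ℕ} where

  private
    firstIs : ∀ s → Decidable (λ (x : Vec PM (suc k)) → lookup x fzero ≡ s)
    firstIs s x = lookup x fzero ≟PM s

  length-filter-first-≡ : ∀ s (L : List (Vec PM k)) →
                          length (filter (firstIs s) (mapₗ (s ∷_) L)) ≡ length L
  length-filter-first-≡ s L =
    trans (cong length (filter-all (firstIs s) (map⁺ (All.universal (λ _ → refl) L))))
          (length-map (s ∷_) L)

  length-filter-first-≢ : ∀ s t → ¬ t ≡ s → (L : List (Vec PM k)) →
                          length (filter (firstIs s) (mapₗ (t ∷_) L)) ≡ 0
  length-filter-first-≢ s t t≢s L =
    cong length (filter-none (firstIs s) (map⁺ (All.universal (λ _ → t≢s) L)))

  length-filter-allVecs : ∀ {P : Pred (Vec PM (suc k)) 0ℓ} (P? : Decidable P) →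
    length (filter P? (allVecs (suc k))) ≡
    length (filter P? (mapₗ (neg ∷_) (allVecs k))) + length (filter P? (mapₗ (pos ∷_) (allVecs k)))
  length-filter-allVecs P? = trans
    (cong length (filter-++ P? (mapₗ (neg ∷_) (allVecs k)) (mapₗ (pos ∷_) (allVecs k))))
    (length-++ (filter P? (mapₗ (neg ∷_) (allVecs k))))

  length-filter-first : ∀ s → length (filter (firstIs s) (allVecs (suc k))) ≡ 2 ^ k
  length-filter-first neg = begin
    length (filter (firstIs neg) (allVecs (suc k)))  ≡⟨ length-filter-allVecs (firstIs neg) ⟩
    length (filter (firstIs neg) (mapₗ (neg ∷_) L)) + length (filter (firstIs neg) (mapₗ (pos ∷_) L))
      ≡⟨ cong₂ _+_ (length-filter-first-≡ neg L) (length-filter-first-≢ neg pos (λ ()) L) ⟩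
    length L + 0  ≡⟨ +-identityʳ _ ⟩
    length L      ≡⟨ length-allVecs k ⟩
    2 ^ k         ∎
    where
    open ≡-Reasoning
    L = allVecs k
  length-filter-first pos = begin
    length (filter (firstIs pos) (allVecs (suc k)))  ≡⟨ length-filter-allVecs (firstIs pos) ⟩
    length (filter (firstIs pos) (mapₗ (neg ∷_) L)) + length (filter (firstIs pos) (mapₗ (pos ∷_) L))
      ≡⟨ cong₂ _+_ (length-filter-first-≢ pos neg (λ ()) L) (length-filter-first-≡ pos L) ⟩
    length L      ≡⟨ length-allVecs k ⟩
    2 ^ k         ∎
    where
    open ≡-Reasoning
    L = allVecs k

countHead-const : ∀ {d n} a b → ¬ a ≡ b → (rest : Vec (Coord PM CubeSym d) n) →
                  countHead (evalSpec cubeAct (const a ∷ rest)) b ≡ 0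
countHead-const {d} a b a≢b rest =
  cong length (filter-none (λ _ → a ≟PM b) (All.universal (λ _ → a≢b) (allVecs d)))

≢-negate : ∀ a → ¬ a ≡ negate a
≢-negate neg ()
≢-negate pos ()

countHead-const-unbalanced : ∀ {d n} a (rest : Vec (Coord PM CubeSym (suc d)) n) →
  ¬ 2 * countHead (evalSpec cubeAct (const a ∷ rest)) (negate a) ≡ 2 ^ suc d
countHead-const-unbalanced {d} a rest balanced = <⇒≢ (m^n>0 2 (suc d))
  (trans (cong (2 *_) (sym (countHead-const a (negate a) (≢-negate a) rest))) balanced)

countHead-first : ∀ {d n} s (rest : Vec (Coord PM CubeSym (suc d)) n) →
                  countHead (evalSpec cubeAct (var idC fzero ∷ rest)) s ≡ 2 ^ d
countHead-first {d} s rest = length-filter-first {d} s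

-- Subcubes whose coordinate 0 is the free coordinate σ(x_j)

module Split {d : ℕ} (σ : CubeSym) (j : Fin (suc d)) where

  vertex : PM → Vec PM d → Vec PM (suc d)
  vertex s u = insertAt u j (cubeAct σ s)

  vertex-injective : ∀ s {u u′} → vertex s u ≡ vertex s u′ → u ≡ u′
  vertex-injective s {u} {u′} eq = begin
    u                        ≡⟨ sym (removeAt-insertAt u j (cubeAct σ s)) ⟩
    removeAt (vertex s u) j  ≡⟨ cong (λ x → removeAt x j) eq ⟩
    removeAt (vertex s u′) j ≡⟨ removeAt-insertAt u′ j (cubeAct σ s) ⟩
    u′                       ∎
    where open ≡-Reasoning

  vertex-removeAt : ∀ x → vertex (cubeAct σ (lookup x j)) (removeAt x j) ≡ x
  vertex-removeAt x =
    trans (cong (insertAt (removeAt x j) j) (cubeAct-involutive σ (lookup x j)))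
          (insertAt-removeAt x j)

  project : Coord PM CubeSym (suc d) → Coord Four TTTSym d
  project (const a) = const (phi a a)
  project (var τ k) with j ≟Fin k
  ... | yes _   = const (phi (cubeAct τ (cubeAct σ neg)) (cubeAct τ (cubeAct σ pos)))
  ... | no j≢k = var (liftSym τ) (punchOut j≢k)

  evalCoord-var-vertex : ∀ τ {k} (j≢k : ¬ j ≡ k) s u →
                         evalCoord cubeAct (var τ k) (vertex s u) ≡ cubeAct τ (lookup u (punchOut j≢k))
  evalCoord-var-vertex τ j≢k s u = cong (cubeAct τ) (begin
    lookup (vertex s u) _
      ≡⟨ cong (lookup (vertex s u)) (sym (punchIn-punchOut j≢k)) ⟩
    lookup (vertex s u) (punchIn j (punchOut j≢k))
      ≡⟨ insertAt-punchIn u j (cubeAct σ s) (punchOut j≢k) ⟩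
    lookup u (punchOut j≢k) ∎)
    where open ≡-Reasoning

  phi-evalCoord-vertex : ∀ c u v →
    phi (evalCoord cubeAct c (vertex neg u)) (evalCoord cubeAct c (vertex pos v))
    ≡ evalCoord tttAct (project c) (zipWith phi u v)
  phi-evalCoord-vertex (const a) u v = refl
  phi-evalCoord-vertex (var τ k) u v with j ≟Fin k
  ... | yes refl rewrite insertAt-lookup u j (cubeAct σ neg) | insertAt-lookup v j (cubeAct σ pos) = refl
  ... | no j≢k = begin
    phi (evalCoord cubeAct (var τ k) (vertex neg u)) (evalCoord cubeAct (var τ k) (vertex pos v))
      ≡⟨ cong₂ phi (evalCoord-var-vertex τ j≢k neg u) (evalCoord-var-vertex τ j≢k pos v) ⟩
    phi (cubeAct τ (lookup u i)) (cubeAct τ (lookup v i))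
      ≡⟨ phi-equivariant τ (lookup u i) (lookup v i) ⟩
    tttAct (liftSym τ) (phi (lookup u i) (lookup v i))
      ≡⟨ cong (tttAct (liftSym τ)) (sym (lookup-zipWith phi i u v)) ⟩
    tttAct (liftSym τ) (lookup (zipWith phi u v) i) ∎
    where
    open ≡-Reasoning
    i = punchOut j≢k

  zipWith-phi-evalSpec-vertex : ∀ {m} (cs : Vec (Coord PM CubeSym (suc d)) m) u v →
    zipWith phi (evalSpec cubeAct cs (vertex neg u)) (evalSpec cubeAct cs (vertex pos v))
    ≡ evalSpec tttAct (mapᵥ project cs) (zipWith phi u v)
  zipWith-phi-evalSpec-vertex []       u v = refl
  zipWith-phi-evalSpec-vertex (c ∷ cs) u v =
    cong₂ _∷_ (phi-evalCoord-vertex c u v) (zipWith-phi-evalSpec-vertex cs u v)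

  evalCoord-vertex-independent : ∀ c s t {u u′} →
    evalCoord cubeAct c (vertex s u) ≡ evalCoord cubeAct c (vertex s u′) →
    evalCoord cubeAct c (vertex t u) ≡ evalCoord cubeAct c (vertex t u′)
  evalCoord-vertex-independent (const a) s t eq = refl
  evalCoord-vertex-independent (var τ k) s t {u} {u′} eq with j ≟Fin k
  ... | yes refl = cong (cubeAct τ) (trans (insertAt-lookup u j (cubeAct σ t))
                                           (sym (insertAt-lookup u′ j (cubeAct σ t))))
  ... | no j≢k = begin
    evalCoord cubeAct (var τ k) (vertex t u)   ≡⟨ evalCoord-var-vertex τ j≢k t u ⟩
    cubeAct τ (lookup u (punchOut j≢k))        ≡⟨ sym (evalCoord-var-vertex τ j≢k s u) ⟩
    evalCoord cubeAct (var τ k) (vertex s u)   ≡⟨ eq ⟩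
    evalCoord cubeAct (var τ k) (vertex s u′)  ≡⟨ evalCoord-var-vertex τ j≢k s u′ ⟩
    cubeAct τ (lookup u′ (punchOut j≢k))       ≡⟨ sym (evalCoord-var-vertex τ j≢k t u′) ⟩
    evalCoord cubeAct (var τ k) (vertex t u′)  ∎
    where open ≡-Reasoning

  evalSpec-vertex-independent : ∀ {m} (cs : Vec (Coord PM CubeSym (suc d)) m) s t {u u′} →
    evalSpec cubeAct cs (vertex s u) ≡ evalSpec cubeAct cs (vertex s u′) →
    evalSpec cubeAct cs (vertex t u) ≡ evalSpec cubeAct cs (vertex t u′)
  evalSpec-vertex-independent []       s t eq = refl
  evalSpec-vertex-independent (c ∷ cs) s t eq with eq₁ , eq₂ ← ∷-injective eq =
    cong₂ _∷_ (evalCoord-vertex-independent c s t eq₁) (evalSpec-vertex-independent cs s t eq₂)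

  module _ {n : ℕ} (rest : Vec (Coord PM CubeSym (suc d)) n) where

    cube : Vec PM (suc d) → Vec PM (suc n)
    cube = evalSpec cubeAct (var σ j ∷ rest)

    ticTacToe : Vec Four d → Vec Four n
    ticTacToe = evalSpec tttAct (mapᵥ project rest)

    head-cube-vertex : ∀ s u → head (cube (vertex s u)) ≡ s
    head-cube-vertex s u =
      trans (cong (cubeAct σ) (insertAt-lookup u j (cubeAct σ s))) (cubeAct-involutive σ s)

    vertex-removeAt-cube : ∀ s x → head (cube x) ≡ s → vertex s (removeAt x j) ≡ x
    vertex-removeAt-cube s x refl = vertex-removeAt x

    edge : Vec PM d × Vec PM d → Vec PM (suc n) × Vec PM (suc n)
    edge (u , v) = cube (vertex neg u) , cube (vertex pos v)

    Phi-edge : ∀ u v → Phi (edge (u , v)) ≡ ticTacToe (zipWith phi u v)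
    Phi-edge = zipWith-phi-evalSpec-vertex rest

    Phi-edge-unzipPhi : ∀ w → Phi (edge (unzipPhi w)) ≡ ticTacToe w
    Phi-edge-unzipPhi w = trans (Phi-edge _ _) (cong ticTacToe (zipWith-phi-unzipPhi w))

    edge-InQ⁻×Q⁺ : ∀ uv → InQ⁻×Q⁺ (edge uv)
    edge-InQ⁻×Q⁺ (u , v) = head-cube-vertex neg u , head-cube-vertex pos v

    edge-injective : Injective _≡_ _≡_ cube → Injective _≡_ _≡_ edge
    edge-injective cube-inj {u , v} {u′ , v′} eq =
      cong₂ _,_ (vertex-injective neg (cube-inj (cong proj₁ eq)))
                (vertex-injective pos (cube-inj (cong proj₂ eq)))

    ticTacToe-injective : Injective _≡_ _≡_ cube → Injective _≡_ _≡_ ticTacToe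
    ticTacToe-injective cube-inj {w} {w′} eq = begin
      w                                   ≡⟨ sym (zipWith-phi-unzipPhi w) ⟩
      uncurry (zipWith phi) (unzipPhi w)  ≡⟨ cong (uncurry (zipWith phi)) unzip≡ ⟩
      uncurry (zipWith phi) (unzipPhi w′) ≡⟨ zipWith-phi-unzipPhi w′ ⟩
      w′                                  ∎
      where
      open ≡-Reasoning
      unzip≡ : unzipPhi w ≡ unzipPhi w′
      unzip≡ = edge-injective cube-inj (Phi-injectiveOnQ⁻×Q⁺ (edge-InQ⁻×Q⁺ _) (edge-InQ⁻×Q⁺ _)
                 (trans (Phi-edge-unzipPhi w) (trans eq (sym (Phi-edge-unzipPhi w′)))))

    -- Two parameters with the same image agree in x_j. The coordinates of rest see the
    -- other parameters u independently of x_j, so the diagonal edges (u, u) and (u′, u′)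
    -- coincide, and Φ maps them to ticTacToe (φ(u,u)) and ticTacToe (φ(u′,u′)).
    cube-injective : Injective _≡_ _≡_ ticTacToe → Injective _≡_ _≡_ cube
    cube-injective ttt-inj {x} {x′} eq = begin
      x               ≡⟨ sym x≡ ⟩
      vertex s u      ≡⟨ cong (vertex s) (cong proj₁ (zipWith-phi-injective (ttt-inj diagonal≡))) ⟩
      vertex s u′     ≡⟨ x′≡ ⟩
      x′              ∎
      where
      open ≡-Reasoning
      s = head (cube x)
      u = removeAt x j
      u′ = removeAt x′ j
      x≡ : vertex s u ≡ x
      x≡ = vertex-removeAt-cube s x refl
      x′≡ : vertex s u′ ≡ x′
      x′≡ = vertex-removeAt-cube s x′ (cong head (sym eq))
      rest≡ : ∀ t → evalSpec cubeAct rest (vertex t u) ≡ evalSpec cubeAct rest (vertex t u′)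
      rest≡ t = evalSpec-vertex-independent rest s t (begin
        tail (cube (vertex s u))   ≡⟨ cong (λ y → tail (cube y)) x≡ ⟩
        tail (cube x)              ≡⟨ cong tail eq ⟩
        tail (cube x′)             ≡⟨ cong (λ y → tail (cube y)) (sym x′≡) ⟩
        tail (cube (vertex s u′))  ∎)
      diagonal≡ : ticTacToe (zipWith phi u u) ≡ ticTacToe (zipWith phi u′ u′)
      diagonal≡ = trans (sym (Phi-edge u u))
                    (trans (cong₂ (zipWith phi) (rest≡ neg) (rest≡ pos)) (Phi-edge u′ u′))

    PhiImage-Bowtie : ∀ {C} → IsImage cube C → ∀ y → PhiImage (Bowtie C) y ⇔ ∃ λ w → ticTacToe w ≡ y
    PhiImage-Bowtie {C} img y = mk⇔ toTicTacToe fromTicTacToe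
      where
      toTicTacToe : PhiImage (Bowtie C) y → ∃ λ w → ticTacToe w ≡ y
      toTicTacToe ((p⁻ , p⁺) , ((p⁻∈C , p⁻∈Q⁻) , (p⁺∈C , p⁺∈Q⁺)) , Φp≡y)
        with x⁻ , refl ← to (img p⁻) p⁻∈C | x⁺ , refl ← to (img p⁺) p⁺∈C =
        zipWith phi u v , (begin
          ticTacToe (zipWith phi u v) ≡⟨ sym (Phi-edge u v) ⟩
          Phi (edge (u , v))          ≡⟨ cong Phi (cong₂ _,_ (cong cube x⁻≡) (cong cube x⁺≡)) ⟩
          Phi (cube x⁻ , cube x⁺)     ≡⟨ Φp≡y ⟩
          y                           ∎)
        where
        open ≡-Reasoning
        u = removeAt x⁻ j
        v = removeAt x⁺ j
        x⁻≡ : vertex neg u ≡ x⁻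
        x⁻≡ = vertex-removeAt-cube neg x⁻ p⁻∈Q⁻
        x⁺≡ : vertex pos v ≡ x⁺
        x⁺≡ = vertex-removeAt-cube pos x⁺ p⁺∈Q⁺
      fromTicTacToe : (∃ λ w → ticTacToe w ≡ y) → PhiImage (Bowtie C) y
      fromTicTacToe (w , refl) =
        edge (u , v) ,
        ((from (img _) (vertex neg u , refl) , head-cube-vertex neg u) ,
         (from (img _) (vertex pos v , refl) , head-cube-vertex pos v)) ,
        Phi-edge-unzipPhi w
        where
        u = proj₁ (unzipPhi w)
        v = proj₂ (unzipPhi w)

PhiImage-cong : ∀ {n} {S S′ : Pred (Vec PM (suc n) × Vec PM (suc n)) 0ℓ} →
                (∀ p → S p ⇔ S′ p) → ∀ y → PhiImage S y ⇔ PhiImage S′ y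
PhiImage-cong S⇔S′ y = mk⇔ (λ (p , Sp , eq) → p , to (S⇔S′ p) Sp , eq)
                           (λ (p , S′p , eq) → p , from (S⇔S′ p) S′p , eq)

hyperbowtie⇒ticTacToe : ∀ {n d} {S : Pred (Vec PM (suc n) × Vec PM (suc n)) 0ℓ} →
                        IsHyperbowtie n d S → IsTicTacToe d n (PhiImage S)
hyperbowtie⇒ticTacToe (C , const neg ∷ rest , _ , _ , twice#⁺ , _) =
  ⊥-elim (countHead-const-unbalanced neg rest twice#⁺)
hyperbowtie⇒ticTacToe (C , const pos ∷ rest , _ , twice#⁻ , _) =
  ⊥-elim (countHead-const-unbalanced pos rest twice#⁻)
hyperbowtie⇒ticTacToe (C , var σ j ∷ rest , (cube-inj , img) , _ , _ , S⇔Bowtie) =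
  mapᵥ project rest ,
  ticTacToe-injective rest cube-inj ,
  λ y → ⇔.trans (PhiImage-cong S⇔Bowtie y) (PhiImage-Bowtie rest img y)
  where open Split σ j

liftCoord : ∀ {d} → Coord Four TTTSym d → Coord PM CubeSym (suc d)
liftCoord (const f1) = const neg
liftCoord (const f2) = var idC fzero
liftCoord (const f3) = var negC fzero
liftCoord (const f4) = const pos
liftCoord (var e k)  = var idC (fsuc k)
liftCoord (var π k)  = var negC (fsuc k)

project-liftCoord : ∀ {d} (c : Coord Four TTTSym d) → Split.project idC fzero (liftCoord c) ≡ c
project-liftCoord (const f1) = refl
project-liftCoord (const f2) = refl
project-liftCoord (const f3) = refl
project-liftCoord (const f4) = refl
project-liftCoord (var e k)  = refl
project-liftCoord (var π k)  = refl

project-map-liftCoord : ∀ {d n} (spec : Vec (Coord Four TTTSym d) n) →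
                        mapᵥ (Split.project idC fzero) (mapᵥ liftCoord spec) ≡ spec
project-map-liftCoord spec =
  trans (sym (map-∘ _ liftCoord spec)) (trans (map-cong project-liftCoord spec) (map-id spec))

ticTacToe⇒hyperbowtie : ∀ {n d} {S : Pred (Vec PM (suc n) × Vec PM (suc n)) 0ℓ} → InQmQp S →
                        IsTicTacToe d n (PhiImage S) → IsHyperbowtie n d S
ticTacToe⇒hyperbowtie {n} {d} {S} S⊆ (spec , ttt-inj , ttt-img) =
  C , var idC fzero ∷ rest ,
  (cube-injective rest ttt-inj′ , λ _ → ⇔.refl) ,
  cong (2 *_) (countHead-first neg rest) ,
  cong (2 *_) (countHead-first pos rest) ,
  λ p → mk⇔ (PhiImage-reflects-⊆ S⊆ (Bowtie⊆Q⁻×Q⁺ C) (λ y → to (PhiImage-S⇔Bowtie y)) p)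
            (PhiImage-reflects-⊆ (Bowtie⊆Q⁻×Q⁺ C) S⊆ (λ y → from (PhiImage-S⇔Bowtie y)) p)
  where
  open Split idC fzero
  rest : Vec (Coord PM CubeSym (suc d)) n
  rest = mapᵥ liftCoord spec
  C : Pred (Vec PM (suc n)) 0ℓ
  C y = ∃ λ x → cube rest x ≡ y
  ttt-inj′ : Injective _≡_ _≡_ (ticTacToe rest)
  ttt-inj′ = subst (λ sp → Injective _≡_ _≡_ (evalSpec tttAct sp))
                   (sym (project-map-liftCoord spec)) ttt-inj
  PhiImage-S⇔Bowtie : ∀ y → PhiImage S y ⇔ PhiImage (Bowtie C) y
  PhiImage-S⇔Bowtie y = ⇔.trans (subst (λ sp → PhiImage S y ⇔ ∃ λ w → evalSpec tttAct sp w ≡ y)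
                              (sym (project-map-liftCoord spec)) (ttt-img y))
                       (⇔.sym (PhiImage-Bowtie rest (λ _ → ⇔.refl) y))

lemma2p1 : (n d : ℕ) → 1 ≤ n → 1 ≤ d →
    (S : Pred (Vec PM (suc n) × Vec PM (suc n)) 0ℓ) → InQmQp S →
    IsHyperbowtie n d S ⇔ IsTicTacToe d n (PhiImage S)
lemma2p1 n d _ _ S S⊆Q⁻×Q⁺ = mk⇔ hyperbowtie⇒ticTacToe (ticTacToe⇒hyperbowtie S⊆Q⁻×Q⁺)
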